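{- Fix integers $i\ge1$ and $k\ge j\ge1$ and let $T=Y(i;j,k)$ with its identity coloring by the simply laced Dynkin diagram $\Gamma$ (see context). Then there is no $\Gamma$-colored minuscule poset with top tree $T$ in each of the following cases: (a) $i>1$ and $k\ge j>1$; (b) $i>2$, $j=1$ and $k>2$; (c) $i>4$, $j=1$ and $k=2$.
   Context: Dynkin diagram $\Gamma$: finite set with integers $\theta_{ab}$, $\theta_{aa}=2$, $\theta_{ab}\le0$ ($a\ne b$), $\theta_{ab}=0\iff\theta_{ba}=0$; $a\sim b$ if $a\ne b$ and $\theta_{ab}<0$; simply laced: all $\theta_{ab}\in\{ -1,0,2\}$. $\Gamma$-colored poset: poset with surjective $\kappa:P\to\Gamma$. Consecutive elements of color $a$: $x<y$ of color $a$, no color-$a$ element in $(x,y)$. $U(x,P)=\{y>x:\kappa(y)\sim\kappa(x)\}$, $L(x,P)=\{y<x:\kappa(y)\sim\kappa(x)\}$. $\Gamma$-colored minuscule: locally finite with (EC) equal colors comparable; (NA) neighbors (one covers the other) have adjacent colors; (AC) adjacent colors comparable; (ICE2) consecutive $x<y$ of color $a$ have $\sum_{z\in(x,y)}-\theta_{\kappa(z),a}=2$; (UCB1) for maximal $x$ of color $a$, $U(x,P)$ finite and $\sum_{y\in U(x,P)}-\theta_{\kappa(y),a}\le1$; (LCB1) for minimal $x$ of color $a$, $L(x,P)$ finite and $\sum_{y\in L(x,P)}-\theta_{\kappa(y),a}\le1$. The top tree of a finite such $P$ is the set of elements maximal among elements of their color; "top tree $T$" means this subposet is isomorphic to $T$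 as a colored poset. $Y(i;j,k)$: a chain $t_1>\dots>t_i$ and disjoint chains $u_1>\dots>u_j$, $v_1>\dots>v_k$, with $t_i$ covering $u_1$ and $v_1$ and no other covers; $\Gamma$ has the elements of $Y(i;j,k)$ as nodes, two adjacent iff one covers the other; the coloring is the identity. -}

module Defs where

open import Data.Nat as ℕ using (ℕ; zero; suc)
open import Data.Fin using (Fin; toℕ)
open import Data.Fin.Properties using () renaming (_≟_ to _≟F_)
open import Data.Integer as ℤ using (ℤ; +_; -_; _<_; _≤_)
open import Data.Bool using (Bool; true; false; if_then_else_; _∧_; _∨_; not)
open import Data.List using (List; foldr; map; allFin)
open import Data.Product using (Σ; ∃; _×_; _,_)
open import Data.Sum using (_⊎_)
open import Relation.Nullary using (¬_; Dec; yes; no)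
open import Relation.Nullary.Decidable using (⌊_⌋)
open import Relation.Binary.PropositionalEquality using (_≡_; _≢_)
open import Relation.Binary.Construct.Closure.ReflexiveTransitive using (Star)
open import Function.Bundles using (_⇔_)

Adj : {C : Set} → (C → C → ℤ) → C → C → Set
Adj θ a b = (a ≢ b) × (θ a b < + 0)

adj? : {C : Set} → ((a b : C) → Dec (a ≡ b)) → (C → C → ℤ) → C → C → Bool
adj? eq θ a b = not ⌊ eq a b ⌋ ∧ ⌊ θ a b ℤ.<? + 0 ⌋

record ColoredPoset (C : Set) (n : ℕ) : Set where
  field
    le      : Fin n → Fin n → Bool
    le-refl : ∀ x → le x x ≡ true
    le-anti : ∀ x y → le x y ≡ true → le y x ≡ true → x ≡ y
    le-trans : ∀ x y z → le x y ≡ true → le y z ≡ true → le x z ≡ true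
    κ       : Fin n → C
    κ-surj  : ∀ a → ∃ λ x → κ x ≡ a

module _ {C : Set} {n : ℕ} (P : ColoredPoset C n) where
  open ColoredPoset P

  _≤P_ : Fin n → Fin n → Set
  x ≤P y = le x y ≡ true

  lt : Fin n → Fin n → Bool
  lt x y = le x y ∧ not ⌊ x ≟F y ⌋

  _<P_ : Fin n → Fin n → Set
  x <P y = lt x y ≡ true

  Covers : Fin n → Fin n → Set
  Covers y x = (x <P y) × (∀ z → ¬ ((x <P z) × (z <P y)))

  Comparable : Fin n → Fin n → Set
  Comparable x y = (x ≤P y) ⊎ (y ≤P x)

  sumWhere : (Fin n → Bool) → (Fin n → ℤ) → ℤ
  sumWhere p f = foldr ℤ._+_ (+ 0) (map (λ z → if p z then f z else + 0) (allFin n))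

  Consecutive : Fin n → Fin n → Set
  Consecutive x y = (x <P y) × (κ x ≡ κ y) ×
                    (∀ z → κ z ≡ κ x → ¬ ((x <P z) × (z <P y)))

  MaxOfColor : Fin n → Set
  MaxOfColor x = ∀ y → κ y ≡ κ x → x ≤P y → y ≡ x

  MinOfColor : Fin n → Set
  MinOfColor x = ∀ y → κ y ≡ κ x → y ≤P x → y ≡ x

  module _ (eq : (a b : C) → Dec (a ≡ b)) (θ : C → C → ℤ) where

    -- Γ-colored minuscule (finite case: local finiteness and finiteness
    -- of U(x,P), L(x,P) are automatic).
    record IsMinuscule : Set where
      field
        EC   : ∀ x y → κ x ≡ κ y → Comparable x y
        NA   : ∀ x y → Covers y x → Adj θ (κ x) (κ y)
        AC   : ∀ x y → Adj θ (κ x) (κ y) → Comparable x y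
        ICE2 : ∀ x y → Consecutive x y →
               sumWhere (λ z → lt x z ∧ lt z y) (λ z → - θ (κ z) (κ x)) ≡ + 2
        UCB1 : ∀ x → MaxOfColor x →
               sumWhere (λ y → lt x y ∧ adj? eq θ (κ y) (κ x))
                        (λ y → - θ (κ y) (κ x)) ≤ + 1
        LCB1 : ∀ x → MinOfColor x →
               sumWhere (λ y → lt y x ∧ adj? eq θ (κ y) (κ x))
                        (λ y → - θ (κ y) (κ x)) ≤ + 1

    -- The top tree (elements maximal among their color) is isomorphic, as a
    -- colored poset, to a colored poset on the color set C with order _≤T_
    -- and identity coloring: f is such an isomorphism from (C, ≤T, id) onto
    -- the top tree.
    record HasTopTree (_≤T_ : C → C → Set) : Set where
      field
        f      : C → Fin n
        f-top  : ∀ a → MaxOfColor (f a)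
        f-onto : ∀ x → MaxOfColor x → ∃ λ a → f a ≡ x
        f-inj  : ∀ a b → f a ≡ f b → a ≡ b
        f-ord  : ∀ a b → (f a ≤P f b) ⇔ (a ≤T b)
        f-col  : ∀ a → κ (f a) ≡ a

-- The tree Y(i;j,k).  t m is t_{m+1} (t 0 = t_1 the top), similarly u, v.

data Node (i j k : ℕ) : Set where
  t : Fin i → Node i j k
  u : Fin j → Node i j k
  v : Fin k → Node i j k

module _ {i j k : ℕ} where

  _≟N_ : (a b : Node i j k) → Dec (a ≡ b)
  t m ≟N t m' with m ≟F m'
  ... | yes Relation.Binary.PropositionalEquality.refl = yes Relation.Binary.PropositionalEquality.refl
  ... | no ne = no λ { Relation.Binary.PropositionalEquality.refl → ne Relation.Binary.PropositionalEquality.refl }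
  u m ≟N u m' with m ≟F m'
  ... | yes Relation.Binary.PropositionalEquality.refl = yes Relation.Binary.PropositionalEquality.refl
  ... | no ne = no λ { Relation.Binary.PropositionalEquality.refl → ne Relation.Binary.PropositionalEquality.refl }
  v m ≟N v m' with m ≟F m'
  ... | yes Relation.Binary.PropositionalEquality.refl = yes Relation.Binary.PropositionalEquality.refl
  ... | no ne = no λ { Relation.Binary.PropositionalEquality.refl → ne Relation.Binary.PropositionalEquality.refl }
  t _ ≟N u _ = no λ ()
  t _ ≟N v _ = no λ ()
  u _ ≟N t _ = no λ ()
  u _ ≟N v _ = no λ ()
  v _ ≟N t _ = no λ ()
  v _ ≟N u _ = no λ ()

  coversY : Node i j k → Node i j k → Bool
  coversY (t m) (t m') = suc (toℕ m) ℕ.≡ᵇ toℕ m'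
  coversY (t m) (u z)  = (suc (toℕ m) ℕ.≡ᵇ i) ∧ (toℕ z ℕ.≡ᵇ 0)
  coversY (t m) (v z)  = (suc (toℕ m) ℕ.≡ᵇ i) ∧ (toℕ z ℕ.≡ᵇ 0)
  coversY (u m) (u m') = suc (toℕ m) ℕ.≡ᵇ toℕ m'
  coversY (v m) (v m') = suc (toℕ m) ℕ.≡ᵇ toℕ m'
  coversY _ _ = false

  _≤Y_ : Node i j k → Node i j k → Set
  a ≤Y b = Star (λ x y → coversY y x ≡ true) a b

  θY : Node i j k → Node i j k → ℤ
  θY a b with a ≟N b
  ... | yes _ = + 2
  ... | no _  = if coversY a b ∨ coversY b a then - (+ 1) else + 0

MinusculeWithTopTreeY : (i j k n : ℕ) → ColoredPoset (Node i j k) n → Set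
MinusculeWithTopTreeY i j k n P =
  IsMinuscule P _≟N_ θY × HasTopTree P _≟N_ θY _≤Y_

module Submission where

-- For an up-closed set U of elements of P let λ_U = ω − Σ_{z ∈ U} α_{κ z}, written in
-- fundamental-weight coordinates, where ω is the fundamental weight of the root r of the top tree.
-- ICE2, UCB1 and the top tree give Σ_{z > x} −θ(κ z, κ x) = 1 − [κ x = r] for every x; with LCB1
-- this shows that all coordinates of λ_U lie in [−1, 1], that λ_{U − y}(κ y) = 1 for a minimal
-- element y of U, and that λ_P ≤ 0.  So λ_P is reached from ω by simple reflections, each applied
-- at a coordinate equal to 1, without leaving the box [−1, 1].  If Y(i; j, k) contains an affine
-- diagram with null vector d, then Σ_a d_a λ_P(a) ≤ 0, whereas summing over P instead gives
-- d_r + Σ_z (−θ d)_{κ z}, which is positive when r is in the support of d or the affine diagram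
-- has a neighbour in Y.  The remaining trees are E₆, E₇ and E₈, where a finite search shows that
-- every weight reachable in this way has a positive coordinate.

open import Defs

module FinitePredicates where

  open import Data.Nat using (ℕ)
  open import Data.Fin using (Fin)
  open import Data.Fin.Subset using (_⊂_)
  open import Data.Fin.Subset.Induction using (⊂-wellFounded)
  open import Data.Fin.Properties using (_≟_; any?)
  open import Data.Bool using (Bool; true; false; _∧_; not)
  open import Data.Bool.Properties using (∧-zeroʳ; ∧-identityʳ) renaming (_≟_ to _≟ᵇ_)
  open import Data.Vec using (tabulate; _[_]=_)
  open import Data.Vec.Properties using (lookup⇒[]=; []=⇒lookup; lookup∘tabulate)
  open import Data.Product using (∃; _×_; _,_)
  open import Induction.WellFounded using (WellFounded; Acc; acc; module Subrelation)
  open import Relation.Binary.Construct.On as On using ()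
  open import Relation.Nullary using (yes; no)
  open import Relation.Nullary.Decidable using (⌊_⌋; _×-dec_)
  open import Relation.Unary using (Decidable)
  open import Data.Empty using (⊥-elim)
  open import Relation.Binary.PropositionalEquality

  true≢false : true ≢ false
  true≢false ()

  ∧-true⁻ : ∀ {a b} → a ∧ b ≡ true → a ≡ true × b ≡ true
  ∧-true⁻ {true} b≡true = refl , b≡true

  ∧-true⁺ : ∀ {a b} → a ≡ true → b ≡ true → a ∧ b ≡ true
  ∧-true⁺ refl refl = refl

  module _ {n : ℕ} where

    ⁅_⁆ : Fin n → Fin n → Bool
    ⁅ x ⁆ z = ⌊ z ≟ x ⌋

    _∖_ : (Fin n → Bool) → Fin n → Fin n → Bool
    (p ∖ x) z = p z ∧ not ⌊ z ≟ x ⌋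

    ⁅⁆-self : ∀ x → ⁅ x ⁆ x ≡ true
    ⁅⁆-self x with x ≟ x
    ... | yes _   = refl
    ... | no  x≢x = ⊥-elim (x≢x refl)

    ⁅⁆-other : ∀ {x z} → z ≢ x → ⁅ x ⁆ z ≡ false
    ⁅⁆-other {x} {z} z≢x with z ≟ x
    ... | yes z≡x = ⊥-elim (z≢x z≡x)
    ... | no  _   = refl

    ∖-self : ∀ p x → (p ∖ x) x ≡ false
    ∖-self p x rewrite ⁅⁆-self x = ∧-zeroʳ (p x)

    ∖-other : ∀ p {x z} → z ≢ x → (p ∖ x) z ≡ p z
    ∖-other p z≢x rewrite ⁅⁆-other z≢x = ∧-identityʳ (p _)

    _⊏_ : (p q : Fin n → Bool) → Set
    p ⊏ q = tabulate p ⊂ tabulate q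

    ⊏-wellFounded : WellFounded _⊏_
    ⊏-wellFounded = On.wellFounded tabulate ⊂-wellFounded

    ⊏-intro : ∀ {p q : Fin n → Bool} → (∀ z → p z ≡ true → q z ≡ true) →
              ∀ w → q w ≡ true → p w ≡ false → p ⊏ q
    ⊏-intro {p} {q} p⊆q w qw pw =
        (λ {z} z∈p → ∈-tabulate q z (p⊆q z (tabulate-∈ p z z∈p)))
      , w , ∈-tabulate q w qw , λ w∈p → true≢false (trans (sym (tabulate-∈ p w w∈p)) pw)
      where
      ∈-tabulate : ∀ (r : Fin n → Bool) z → r z ≡ true → tabulate r [ z ]= true
      ∈-tabulate r z rz = lookup⇒[]= z (tabulate r) (trans (lookup∘tabulate r z) rz)
      tabulate-∈ : ∀ (r : Fin n → Bool) z → tabulate r [ z ]= true → r z ≡ true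
      tabulate-∈ r z z∈r = trans (sym (lookup∘tabulate r z)) ([]=⇒lookup z∈r)

  module StrictOrder {n : ℕ} (R : Fin n → Fin n → Bool)
    (R-trans : ∀ {x y z} → R x y ≡ true → R y z ≡ true → R x z ≡ true)
    (R-irrefl : ∀ x → R x x ≡ false) where

    _≺_ : Fin n → Fin n → Set
    x ≺ y = R x y ≡ true

    ≺-wellFounded : WellFounded _≺_
    ≺-wellFounded = Subrelation.wellFounded below-⊏ (On.wellFounded below ⊏-wellFounded)
      where
      below : Fin n → Fin n → Bool
      below x z = R z x
      below-⊏ : ∀ {x y} → x ≺ y → below x ⊏ below y
      below-⊏ {x} x≺y = ⊏-intro (λ z z≺x → R-trans z≺x x≺y) x x≺y (R-irrefl x)

    Minimal : (Fin n → Set) → Fin n → Set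
    Minimal Q m = Q m × (∀ z → Q z → R z m ≡ false)

    minimal : {Q : Fin n → Set} → Decidable Q → ∀ {y} → Q y → ∃ (Minimal Q)
    minimal {Q} Q? {y} Qy = descend Qy (≺-wellFounded y)
      where
      descend : ∀ {y} → Q y → Acc _≺_ y → ∃ (Minimal Q)
      descend {y} Qy (acc rs) with any? (λ z → Q? z ×-dec (R z y ≟ᵇ true))
      ... | yes (z , Qz , z≺y) = descend Qz (rs z≺y)
      ... | no  none           = y , Qy , nothing-below
        where
        nothing-below : ∀ z → Q z → R z y ≡ false
        nothing-below z Qz with R z y in z≺y
        ... | false = refl
        ... | true  = ⊥-elim (none (z , Qz , z≺y))



open FinitePredicates

module FinSums where

  open import Data.Nat using (zero; suc)
  open import Data.Fin using (Fin; zero; suc)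
  open import Data.Fin.Properties using (_≟_; suc-injective)
  open import Data.Integer using (ℤ; +_; 0ℤ; _+_; _*_; _≤_)
  open import Data.Integer.Properties hiding (_≟_)
  open import Data.Integer.Properties using () renaming (_≟_ to _≟ℤ_)
  open import Algebra.Properties.Semiring.Sum +-*-semiring public
    using (sum; sum-cong-≗; ∑-distrib-+; ∑-comm; *-distribˡ-sum)
  open import Data.Bool using (Bool; true; false; if_then_else_)
  open import Data.Bool.Properties using (∧-identityʳ)
  open import Data.List using (foldr; map; allFin; tabulate)
  open import Data.List.Properties using (map-tabulate)
  open import Relation.Nullary using (yes; no)
  open import Relation.Binary.PropositionalEquality
  open import Function using (_∘_; id)

  _◃_ : ∀ {n} → (Fin n → Bool) → (Fin n → ℤ) → Fin n → ℤ
  (p ◃ g) z = if p z then g z else 0ℤ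

  ◃-true : ∀ {n} (p : Fin n → Bool) (g : Fin n → ℤ) {z} → p z ≡ true → (p ◃ g) z ≡ g z
  ◃-true p g pz rewrite pz = refl

  ◃-false : ∀ {n} (p : Fin n → Bool) (g : Fin n → ℤ) {z} → p z ≡ false → (p ◃ g) z ≡ 0ℤ
  ◃-false p g pz rewrite pz = refl

  ◃-zero : ∀ {n} (p : Fin n → Bool) (g : Fin n → ℤ) {z} → g z ≡ 0ℤ → (p ◃ g) z ≡ 0ℤ
  ◃-zero p g {z} gz with p z
  ... | true  = gz
  ... | false = refl

  foldr-tabulate : ∀ {n} (g : Fin n → ℤ) → foldr _+_ 0ℤ (tabulate g) ≡ sum g
  foldr-tabulate {zero}  g = refl
  foldr-tabulate {suc n} g = cong (_+_ (g zero)) (foldr-tabulate (g ∘ suc))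

  foldr-map-allFin : ∀ {n} (g : Fin n → ℤ) → foldr _+_ 0ℤ (map g (allFin n)) ≡ sum g
  foldr-map-allFin g = trans (cong (foldr _+_ 0ℤ) (map-tabulate id g)) (foldr-tabulate g)

  sum-mono-≤ : ∀ {n} {f g : Fin n → ℤ} → (∀ z → f z ≤ g z) → sum f ≤ sum g
  sum-mono-≤ {zero}  f≤g = ≤-refl
  sum-mono-≤ {suc n} f≤g = +-mono-≤ (f≤g zero) (sum-mono-≤ (f≤g ∘ suc))

  sum-nonneg : ∀ {n} {f : Fin n → ℤ} → (∀ z → 0ℤ ≤ f z) → 0ℤ ≤ sum f
  sum-nonneg {zero}  0≤f = ≤-refl
  sum-nonneg {suc n} 0≤f = +-mono-≤ (0≤f zero) (sum-nonneg (0≤f ∘ suc))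

  sum-nonpos : ∀ {n} {f : Fin n → ℤ} → (∀ z → f z ≤ 0ℤ) → sum f ≤ 0ℤ
  sum-nonpos {zero}  f≤0 = ≤-refl
  sum-nonpos {suc n} f≤0 = +-mono-≤ (f≤0 zero) (sum-nonpos (f≤0 ∘ suc))

  term≤sum : ∀ {n} {f : Fin n → ℤ} → (∀ z → 0ℤ ≤ f z) → ∀ x → f x ≤ sum f
  term≤sum {suc n} {f} 0≤f zero =
    subst (_≤ sum f) (+-identityʳ (f zero)) (+-monoʳ-≤ (f zero) (sum-nonneg (0≤f ∘ suc)))
  term≤sum {suc n} {f} 0≤f (suc x) =
    subst (_≤ sum f) (+-identityˡ (f (suc x))) (+-mono-≤ (0≤f zero) (term≤sum (0≤f ∘ suc) x))

  sum-zero : ∀ {n} {f : Fin n → ℤ} → (∀ z → f z ≡ 0ℤ) → sum f ≡ 0ℤ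
  sum-zero {zero}  f≡0 = refl
  sum-zero {suc n} f≡0 = cong₂ _+_ (f≡0 zero) (sum-zero (f≡0 ∘ suc))

  sum-single : ∀ {n} {f : Fin n → ℤ} x → (∀ z → z ≢ x → f z ≡ 0ℤ) → sum f ≡ f x
  sum-single {suc n} {f} zero f≡0 =
    trans (cong (_+_ (f zero)) (sum-zero (λ z → f≡0 (suc z) λ ()))) (+-identityʳ (f zero))
  sum-single {suc n} {f} (suc x) f≡0 =
    trans (cong (_+ sum (f ∘ suc)) (f≡0 zero λ ()))
          (trans (+-identityˡ _) (sum-single x (λ z z≢x → f≡0 (suc z) (z≢x ∘ suc-injective))))

  sum-◃-⁅⁆ : ∀ {n} (g : Fin n → ℤ) x → sum (⁅ x ⁆ ◃ g) ≡ g x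
  sum-◃-⁅⁆ g x =
    trans (sum-single x (λ z z≢x → ◃-false ⁅ x ⁆ g (⁅⁆-other z≢x))) (◃-true ⁅ x ⁆ g (⁅⁆-self x))

  ◃-cong-support : ∀ {n} {p q : Fin n → Bool} (g : Fin n → ℤ) →
    (∀ z → g z ≢ 0ℤ → p z ≡ q z) → sum (p ◃ g) ≡ sum (q ◃ g)
  ◃-cong-support {p = p} {q} g same = sum-cong-≗ pointwise
    where
    pointwise : ∀ z → (p ◃ g) z ≡ (q ◃ g) z
    pointwise z with g z ≟ℤ 0ℤ
    ... | yes gz≡0 = trans (◃-zero p g gz≡0) (sym (◃-zero q g gz≡0))
    ... | no  gz≢0 = cong (λ b → if b then g z else 0ℤ) (same z gz≢0)

  ◃-mono-support : ∀ {n} {p q : Fin n → Bool} (g : Fin n → ℤ) →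
    (∀ z → g z ≢ 0ℤ → p z ≡ true → q z ≡ true) → (∀ z → q z ≡ true → 0ℤ ≤ g z) →
    sum (p ◃ g) ≤ sum (q ◃ g)
  ◃-mono-support {p = p} {q} g p⊆q 0≤g = sum-mono-≤ pointwise
    where
    pointwise : ∀ z → (p ◃ g) z ≤ (q ◃ g) z
    pointwise z with p z in pz | q z in qz
    ... | false | false = ≤-refl
    ... | false | true  = 0≤g z qz
    ... | true  | true  = ≤-refl
    ... | true  | false = ≤-reflexive (gz≡0)
      where
      gz≡0 : g z ≡ 0ℤ
      gz≡0 with g z ≟ℤ 0ℤ
      ... | yes e = e
      ... | no ne with () ← trans (sym (p⊆q z ne pz)) qz

  ◃-nonneg : ∀ {n} (p : Fin n → Bool) {g : Fin n → ℤ} → (∀ z → p z ≡ true → 0ℤ ≤ g z) →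
             ∀ z → 0ℤ ≤ (p ◃ g) z
  ◃-nonneg p 0≤g z with p z in pz
  ... | true  = 0≤g z pz
  ... | false = ≤-refl

  *-nonneg : ∀ d {x : ℤ} → 0ℤ ≤ x → 0ℤ ≤ + d * x
  *-nonneg d 0≤x = subst (_≤ + d * _) (*-zeroʳ (+ d)) (*-monoˡ-≤-nonNeg (+ d) 0≤x)

  *-nonpos : ∀ d {x : ℤ} → x ≤ 0ℤ → + d * x ≤ 0ℤ
  *-nonpos d x≤0 = subst (+ d * _ ≤_) (*-zeroʳ (+ d)) (*-monoˡ-≤-nonNeg (+ d) x≤0)

  sum-◃-∖ : ∀ {n} (p : Fin n → Bool) (g : Fin n → ℤ) {x} → p x ≡ true →
    sum (p ◃ g) ≡ sum ((p ∖ x) ◃ g) + g x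
  sum-◃-∖ p g {x} px =
    trans (sum-cong-≗ pointwise) (trans (∑-distrib-+ ((p ∖ x) ◃ g) (⁅ x ⁆ ◃ g))
                                         (cong (_+_ (sum ((p ∖ x) ◃ g))) (sum-◃-⁅⁆ g x)))
    where
    pointwise : ∀ z → (p ◃ g) z ≡ ((p ∖ x) ◃ g) z + (⁅ x ⁆ ◃ g) z
    pointwise z with z ≟ x
    ... | yes refl rewrite px = sym (+-identityˡ (g z))
    ... | no  _    = sym (trans (+-identityʳ _) (cong (λ b → if b then g z else 0ℤ) (∧-identityʳ (p z))))

open FinSums

module PosetFacts where

  open import Data.Nat using (ℕ)
  open import Data.Fin.Properties using (_≟_)
  open import Data.Bool using (true; false)
  open import Data.Bool.Properties using (∧-zeroʳ)
  open import Data.Sum using (_⊎_; inj₁; inj₂)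
  open import Relation.Nullary using (yes; no)
  open import Data.Empty using (⊥-elim)
  open import Relation.Binary.PropositionalEquality
  open import Function using (case_of_)

  module _ {C : Set} {n : ℕ} (P : ColoredPoset C n) where
    open ColoredPoset P

    <-irrefl : ∀ x → lt P x x ≡ false
    <-irrefl x with x ≟ x
    ... | yes _   = ∧-zeroʳ (le x x)
    ... | no  x≢x = ⊥-elim (x≢x refl)

    <⇒≤ : ∀ {x y} → lt P x y ≡ true → le x y ≡ true
    <⇒≤ {x} {y} x<y with le x y
    ... | true = refl

    <⇒≢ : ∀ {x y} → lt P x y ≡ true → x ≢ y
    <⇒≢ {x} x<y refl = true≢false (trans (sym x<y) (<-irrefl x))

    ≤∧≢⇒< : ∀ {x y} → le x y ≡ true → x ≢ y → lt P x y ≡ true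
    ≤∧≢⇒< {x} {y} x≤y x≢y with x ≟ y
    ... | yes x≡y = ⊥-elim (x≢y x≡y)
    ... | no  _   rewrite x≤y = refl

    ≤⇒≡⊎< : ∀ {x y} → le x y ≡ true → x ≡ y ⊎ lt P x y ≡ true
    ≤⇒≡⊎< {x} {y} x≤y = case x ≟ y of λ where
      (yes x≡y) → inj₁ x≡y
      (no  x≢y) → inj₂ (≤∧≢⇒< x≤y x≢y)

    <-trans : ∀ {x y z} → lt P x y ≡ true → lt P y z ≡ true → lt P x z ≡ true
    <-trans {x} {y} {z} x<y y<z = ≤∧≢⇒< (le-trans x y z (<⇒≤ x<y) (<⇒≤ y<z)) x≢z
      where
      x≢z : x ≢ z
      x≢z refl = <⇒≢ x<y (le-anti x y (<⇒≤ x<y) (<⇒≤ y<z))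

    <-asym : ∀ {x y} → lt P x y ≡ true → lt P y x ≡ false
    <-asym {x} {y} x<y with lt P y x in y<x
    ... | false = refl
    ... | true  = ⊥-elim (<⇒≢ x<y (le-anti x y (<⇒≤ x<y) (<⇒≤ y<x)))

    comparable-trichotomy : ∀ {x y} → Comparable P x y → x ≡ y ⊎ lt P x y ≡ true ⊎ lt P y x ≡ true
    comparable-trichotomy (inj₁ x≤y) with ≤⇒≡⊎< x≤y
    ... | inj₁ x≡y = inj₁ x≡y
    ... | inj₂ x<y = inj₂ (inj₁ x<y)
    comparable-trichotomy (inj₂ y≤x) with ≤⇒≡⊎< y≤x
    ... | inj₁ y≡x = inj₁ (sym y≡x)
    ... | inj₂ y<x = inj₂ (inj₂ y<x)

open PosetFacts

module OrbitExploration where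

  open import Data.Nat using (ℕ; zero; suc)
  open import Data.Nat.GeneralisedArithmetic using (iterate; iterate-is-fold)
  open import Data.Integer using (ℤ; -_; 0ℤ; 1ℤ; -1ℤ; _+_; _≤_; _<_; _≤?_; _<?_)
  import Data.Integer.Properties as ℤP
  open import Data.Bool using (if_then_else_)
  open import Data.List using (List; []; _∷_; map; zipWith; filter; concatMap; deduplicate)
  open import Data.List.Properties using (≡-dec)
  open import Data.List.Relation.Unary.All as All using (All; []; _∷_; all?)
  import Data.List.Relation.Unary.All.Properties as All
  open import Data.List.Relation.Unary.Any as Any using (Any; here; there; any?)
  import Data.List.Relation.Unary.Any.Properties as Any
  open import Data.List.Membership.Propositional using (_∈_)
  open import Data.List.Membership.Propositional.Properties
    using (∈-map⁺; ∈-filter⁺; ∈-concatMap⁺; ∈-deduplicate⁺)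
  open import Data.Product using (∃; _×_; _,_)
  open import Data.Empty using (⊥-elim)
  open import Relation.Binary.Definitions using (DecidableEquality)
  open import Relation.Nullary using (¬_; Dec; yes; no)
  open import Relation.Nullary.Decidable using (⌊_⌋; _×-dec_)
  open import Relation.Binary.PropositionalEquality

  module Exploration {C : Set} (_≟_ : DecidableEquality C) (θ : C → C → ℤ)
    (colors : List C) (complete : ∀ a → a ∈ colors) where

    State : Set
    State = List ℤ

    encode : (C → ℤ) → State
    encode g = map g colors

    lookupColor : List C → State → C → ℤ
    lookupColor (c ∷ cs) (x ∷ xs) a = if ⌊ c ≟ a ⌋ then x else lookupColor cs xs a
    lookupColor _        _        a = 0ℤ

    coord : State → C → ℤ
    coord = lookupColor colors

    reflect : State → C → State
    reflect vs a = zipWith (λ x c → x + - θ a c) vs colors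

    Bounded : ℤ → Set
    Bounded x = -1ℤ ≤ x × x ≤ 1ℤ

    InRange : State → Set
    InRange = All Bounded

    inRange? : ∀ vs → Dec (InRange vs)
    inRange? = all? λ x → (-1ℤ ≤? x) ×-dec (x ≤? 1ℤ)

    HasPositive : State → Set
    HasPositive = Any (0ℤ <_)

    data Reachable (start : State) : State → Set where
      here       : Reachable start start
      reflect-at : ∀ {vs} a → Reachable start vs → coord vs a ≡ 1ℤ → InRange (reflect vs a) →
                   Reachable start (reflect vs a)

    reflectable? : ∀ vs a → Dec (coord vs a ≡ 1ℤ × InRange (reflect vs a))
    reflectable? vs a = (coord vs a ℤP.≟ 1ℤ) ×-dec inRange? (reflect vs a)

    successors : State → List State
    successors vs = map (reflect vs) (filter (reflectable? vs) colors)

    next : List State → List State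
    next L = deduplicate (≡-dec ℤP._≟_) (concatMap successors L)

    Explored : ℕ → List State → Set
    Explored zero    L = L ≡ []
    Explored (suc f) L = All HasPositive L × Explored f (next L)

    explored? : ∀ f L → Dec (Explored f L)
    explored? zero    []      = yes refl
    explored? zero    (_ ∷ _) = no λ ()
    explored? (suc f) L       = all? (any? (0ℤ <?_)) L ×-dec explored? f (next L)

    next-complete : ∀ {L vs} a → vs ∈ L → coord vs a ≡ 1ℤ → InRange (reflect vs a) →
                    reflect vs a ∈ next L
    next-complete a vs∈L is-one in-range =
      ∈-deduplicate⁺ (≡-dec ℤP._≟_) (∈-concatMap⁺ successors (Any.map (λ { refl → successor }) vs∈L))
      where
      successor : reflect _ a ∈ successors _
      successor = ∈-map⁺ (reflect _) (∈-filter⁺ (reflectable? _) (complete a) (is-one , in-range))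

    layer : State → ℕ → List State
    layer start = iterate next (start ∷ [])

    layer-suc : ∀ start s → layer start (suc s) ≡ next (layer start s)
    layer-suc start s =
      trans (sym (iterate-is-fold (start ∷ []) next (suc s)))
            (cong next (iterate-is-fold (start ∷ []) next s))

    reachable-in-layer : ∀ {start vs} → Reachable start vs → ∃ λ s → vs ∈ layer start s
    reachable-in-layer here = 0 , here refl
    reachable-in-layer (reflect-at a r is-one in-range) with reachable-in-layer r
    ... | s , vs∈layer =
      suc s , subst (_ ∈_) (sym (layer-suc _ s)) (next-complete a vs∈layer is-one in-range)

    iterate-[] : ∀ s → iterate next [] s ≡ []
    iterate-[] zero    = refl
    iterate-[] (suc s) = iterate-[] s

    explored-positive : ∀ {f L} → Explored f L → ∀ s → All HasPositive (iterate next L s)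
    explored-positive {zero}  refl          s       = subst (All HasPositive) (sym (iterate-[] s)) []
    explored-positive {suc f} (positive , _) zero    = positive
    explored-positive {suc f} (_ , rest)     (suc s) = explored-positive rest s

    reachable-positive : ∀ {f start vs} → Explored f (start ∷ []) → Reachable start vs → HasPositive vs
    reachable-positive explored r with reachable-in-layer r
    ... | s , vs∈layer = All.lookup (explored-positive explored s) vs∈layer

    coord-encode : ∀ g a → coord (encode g) a ≡ g a
    coord-encode g a = go colors (complete a)
      where
      go : ∀ cs → a ∈ cs → lookupColor cs (map g cs) a ≡ g a
      go (c ∷ cs) a∈ with c ≟ a | a∈
      ... | yes refl | _          = refl
      ... | no  c≢a  | here a≡c   = ⊥-elim (c≢a (sym a≡c))
      ... | no  _    | there a∈cs = go cs a∈cs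

    reflect-encode : ∀ g a → reflect (encode g) a ≡ encode (λ b → g b + - θ a b)
    reflect-encode g a = go colors
      where
      go : ∀ cs → zipWith (λ x c → x + - θ a c) (map g cs) cs ≡ map (λ b → g b + - θ a b) cs
      go []       = refl
      go (c ∷ cs) = cong (_ ∷_) (go cs)

    encode-inRange : ∀ g → (∀ b → Bounded (g b)) → InRange (encode g)
    encode-inRange g bounded = All.map⁺ (All.universal bounded colors)

    encode-nonpos : ∀ g → (∀ b → g b ≤ 0ℤ) → ¬ HasPositive (encode g)
    encode-nonpos g nonpos positive with Any.satisfied (Any.map⁻ positive)
    ... | b , 0<gb = ℤP.<⇒≱ 0<gb (nonpos b)

open OrbitExploration

module Weights where

  open import Data.List using (List; []; _∷_)
  open import Data.List.Properties using (map-cong)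
  open import Data.List.Membership.Propositional using (_∈_)
  open import Data.Nat as ℕ using (ℕ; z≤n; s≤s)
  open import Data.Fin using (Fin)
  open import Data.Fin.Properties using (any?)
  open import Data.Integer using (ℤ; +_; -_; 0ℤ; 1ℤ; -1ℤ; -[1+_]; _+_; _*_; _≤_; _<_; +≤+; +<+; -≤+; -<+)
  import Data.Integer.Properties as ℤP
  open import Data.Bool using (Bool; true; false; if_then_else_; _∧_)
  open import Data.Bool.Properties using (∧-zeroʳ; ∧-identityʳ; ¬-not) renaming (_≟_ to _≟ᵇ_)
  open import Data.Product using (∃; _×_; _,_; proj₁; proj₂)
  open import Data.Sum using (_⊎_; inj₁; inj₂)
  open import Data.Empty using (⊥; ⊥-elim)
  open import Function using (case_of_; _∘_)
  open import Function.Bundles using (Equivalence)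
  open import Induction.WellFounded using (Acc; acc)
  open import Relation.Binary.Definitions using (DecidableEquality)
  open import Relation.Nullary using (yes; no)
  open import Relation.Nullary.Decidable using (⌊_⌋; _×-dec_)
  open import Relation.Binary.PropositionalEquality

  fundamental : ∀ {C : Set} → DecidableEquality C → C → C → ℤ
  fundamental _≟_ r a = if ⌊ a ≟ r ⌋ then 1ℤ else 0ℤ

  pairing : ∀ {C : Set} → (C → C → ℤ) → ∀ {m} → (Fin m → C × ℕ) → C → ℤ
  pairing θ S c = sum (λ i → + proj₂ (S i) * - θ c (proj₁ (S i)))

  module MinusculeWeights
    {C : Set} (_≟_ : DecidableEquality C) (θ : C → C → ℤ)
    (θ-diag : ∀ a → θ a a ≡ + 2)
    (θ-offdiag : ∀ {a b} → a ≢ b → θ a b ≡ -1ℤ ⊎ θ a b ≡ 0ℤ)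
    (_≤T_ : C → C → Set) (root : C) (≤T-root : ∀ a → a ≤T root)
    (parent : ∀ a → a ≢ root → ∃ λ b → a ≤T b × θ b a ≡ -1ℤ)
    {n : ℕ} (P : ColoredPoset C n) (M : IsMinuscule P _≟_ θ) (H : HasTopTree P _≟_ θ _≤T_)
    where

    open ColoredPoset P
    open IsMinuscule M
    open HasTopTree H

    module Below = StrictOrder (lt P) (<-trans P) (<-irrefl P)
    module Above = StrictOrder (λ x y → lt P y x) (λ y<x z<y → <-trans P z<y y<x) (<-irrefl P)

    ↑ ↓ : Fin n → Fin n → Bool
    ↑ x z = lt P x z
    ↓ x z = lt P z x

    -- weight U a is the a-coordinate of ω − Σ_{z ∈ U} α_{κ z}; wt a z is that of −α_{κ z}.
    wt : C → Fin n → ℤ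
    wt a z = - θ (κ z) a

    wt-self : ∀ z → wt (κ z) z ≡ -[1+ 1 ]
    wt-self z = cong -_ (θ-diag (κ z))

    -θ-nonneg : ∀ {a b} → a ≢ b → 0ℤ ≤ - θ a b
    -θ-nonneg a≢b with θ-offdiag a≢b
    ... | inj₁ θ≡-1 rewrite θ≡-1 = +≤+ z≤n
    ... | inj₂ θ≡0  rewrite θ≡0  = +≤+ z≤n

    wt-nonneg : ∀ {a z} → κ z ≢ a → 0ℤ ≤ wt a z
    wt-nonneg = -θ-nonneg

    wt-support : ∀ x z → wt (κ x) z ≡ 0ℤ ⊎ z ≡ x ⊎ lt P z x ≡ true ⊎ lt P x z ≡ true
    wt-support x z with κ z ≟ κ x
    ... | yes same = inj₂ (comparable-trichotomy P (EC z x same))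
    ... | no  diff with θ-offdiag diff
    ...   | inj₂ θ≡0  = inj₁ (cong -_ θ≡0)
    ...   | inj₁ θ≡-1 = inj₂ (comparable-trichotomy P (AC z x (diff , subst (_< 0ℤ) (sym θ≡-1) -<+)))

    ≤-top : ∀ z → le z (f (κ z)) ≡ true
    ≤-top z with EC z (f (κ z)) (sym (f-col (κ z)))
    ... | inj₁ z≤top = z≤top
    ... | inj₂ top≤z = subst (λ y → le y (f (κ z)) ≡ true)
                         (sym (f-top (κ z) z (sym (f-col (κ z))) top≤z)) (le-refl (f (κ z)))

    top-unique : ∀ x → MaxOfColor P x → x ≡ f (κ x)
    top-unique x x-max with f-onto x x-max
    ... | a , fa≡x = trans (sym fa≡x) (cong f (trans (sym (f-col a)) (cong κ fa≡x)))

    f-mono : ∀ {a b} → a ≤T b → le (f a) (f b) ≡ true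
    f-mono {a} {b} = Equivalence.from (f-ord a b)

    nothing-above-root : ∀ z → lt P (f root) z ≡ false
    nothing-above-root z with lt P (f root) z in root<z
    ... | false = refl
    ... | true  = ⊥-elim (<⇒≢ P root<z (le-anti (f root) z (<⇒≤ P root<z) z≤root))
      where
      z≤root : le z (f root) ≡ true
      z≤root = le-trans z (f (κ z)) (f root) (≤-top z) (f-mono (≤T-root (κ z)))

    sumWhere≡sum : ∀ (p : Fin n → Bool) g → sumWhere P p g ≡ sum (p ◃ g)
    sumWhere≡sum p g = foldr-map-allFin (p ◃ g)

    ω : C → ℤ
    ω = fundamental _≟_ root

    ω-root : ω root ≡ 1ℤ
    ω-root with root ≟ root
    ... | yes _ = refl
    ... | no  r≢r = ⊥-elim (r≢r refl)

    ω-nonneg : ∀ a → 0ℤ ≤ ω a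
    ω-nonneg a with ⌊ a ≟ root ⌋
    ... | true  = +≤+ z≤n
    ... | false = +≤+ z≤n

    weight : (Fin n → Bool) → C → ℤ
    weight U a = ω a + sum (U ◃ wt a)

    split-at : ∀ (p : Fin n → Bool) y → p y ≡ true → (∀ z → lt P y z ≡ true → p z ≡ true) →
      sum (p ◃ wt (κ y)) ≡
      (sum (↑ y ◃ wt (κ y)) + wt (κ y) y) + sum ((λ z → p z ∧ ↓ y z) ◃ wt (κ y))
    split-at p y py above⊆p = begin
      sum (p ◃ g)                      ≡⟨ sum-cong-≗ pointwise ⟩
      sum (λ z → (A z + B z) + D z)    ≡⟨ ∑-distrib-+ (λ z → A z + B z) D ⟩
      sum (λ z → A z + B z) + sum D    ≡⟨ cong (_+ sum D) (∑-distrib-+ A B) ⟩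
      (sum A + sum B) + sum D          ≡⟨ cong (λ s → (sum A + s) + sum D) (sum-◃-⁅⁆ g y) ⟩
      (sum A + g y) + sum D            ∎
      where
      open ≡-Reasoning
      g A B D : Fin n → ℤ
      g = wt (κ y)
      A = ↑ y ◃ g
      B = ⁅ y ⁆ ◃ g
      D = (λ z → p z ∧ ↓ y z) ◃ g
      pointwise : ∀ z → (p ◃ g) z ≡ (A z + B z) + D z
      pointwise z with wt-support y z
      ... | inj₁ gz≡0 = trans (◃-zero p g gz≡0) (sym (cong₂ _+_
        (cong₂ _+_ (◃-zero (↑ y) g gz≡0) (◃-zero ⁅ y ⁆ g gz≡0))
        (◃-zero (λ z → p z ∧ ↓ y z) g gz≡0)))
      ... | inj₂ (inj₁ refl) = sym (begin
        (A y + B y) + D y      ≡⟨ cong₂ (λ l r → (l + r) + D y) (◃-false (↑ y) g (<-irrefl P y))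
                                     (◃-true ⁅ y ⁆ g (⁅⁆-self y)) ⟩
        (0ℤ + g y) + D y       ≡⟨ cong (_+_ (0ℤ + g y)) (◃-false (λ z → p z ∧ ↓ y z) g
                                     (trans (cong (p y ∧_) (<-irrefl P y)) (∧-zeroʳ (p y)))) ⟩
        (0ℤ + g y) + 0ℤ        ≡⟨ ℤP.+-identityʳ _ ⟩
        0ℤ + g y               ≡⟨ ℤP.+-identityˡ _ ⟩
        g y                    ≡⟨ sym (◃-true p g py) ⟩
        (p ◃ g) y              ∎)
      ... | inj₂ (inj₂ (inj₁ z<y)) = sym (begin
        (A z + B z) + D z      ≡⟨ cong₂ (λ l r → (l + r) + D z) (◃-false (↑ y) g (<-asym P z<y))
                                     (◃-false ⁅ y ⁆ g (⁅⁆-other (<⇒≢ P z<y))) ⟩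
        0ℤ + D z               ≡⟨ ℤP.+-identityˡ _ ⟩
        D z                    ≡⟨ cong (λ b → if b then g z else 0ℤ)
                                     (trans (cong (p z ∧_) z<y) (∧-identityʳ (p z))) ⟩
        (p ◃ g) z              ∎)
      ... | inj₂ (inj₂ (inj₂ y<z)) = sym (begin
        (A z + B z) + D z      ≡⟨ cong₂ (λ l r → (l + r) + D z) (◃-true (↑ y) g y<z)
                                     (◃-false ⁅ y ⁆ g (⁅⁆-other (λ z≡y → <⇒≢ P y<z (sym z≡y)))) ⟩
        (g z + 0ℤ) + D z       ≡⟨ cong (_+_ (g z + 0ℤ)) (◃-false (λ z → p z ∧ ↓ y z) g
                                     (trans (cong (p z ∧_) (<-asym P y<z)) (∧-zeroʳ (p z)))) ⟩
        (g z + 0ℤ) + 0ℤ        ≡⟨ ℤP.+-identityʳ _ ⟩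
        g z + 0ℤ               ≡⟨ ℤP.+-identityʳ _ ⟩
        g z                    ≡⟨ sym (◃-true p g (above⊆p z y<z)) ⟩
        (p ◃ g) z              ∎)

    weight-split : ∀ (p : Fin n → Bool) y → weight (↑ y) (κ y) ≡ 1ℤ → p y ≡ true →
      (∀ z → lt P y z ≡ true → p z ≡ true) →
      weight p (κ y) ≡ -1ℤ + sum ((λ z → p z ∧ ↓ y z) ◃ wt (κ y))
    weight-split p y above≡1 py above⊆p = begin
      ω a + sum (p ◃ wt a)          ≡⟨ cong (_+_ (ω a)) (split-at p y py above⊆p) ⟩
      ω a + ((S + wt a y) + D)      ≡⟨ sym (ℤP.+-assoc (ω a) (S + wt a y) D) ⟩
      (ω a + (S + wt a y)) + D      ≡⟨ cong (_+ D) (sym (ℤP.+-assoc (ω a) S (wt a y))) ⟩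
      ((ω a + S) + wt a y) + D      ≡⟨ cong₂ (λ l r → (l + r) + D) above≡1 (wt-self y) ⟩
      -1ℤ + D                       ∎
      where
      open ≡-Reasoning
      a = κ y
      S = sum (↑ y ◃ wt a)
      D = sum ((λ z → p z ∧ ↓ y z) ◃ wt a)

    sumWhere-adj : ∀ (p : Fin n → Bool) a → (∀ z → p z ≡ true → κ z ≢ a) →
      sumWhere P (λ z → p z ∧ adj? _≟_ θ (κ z) a) (wt a) ≡ sum (p ◃ wt a)
    sumWhere-adj p a off-color = trans (sumWhere≡sum _ (wt a)) (◃-cong-support (wt a) same)
      where
      same : ∀ z → wt a z ≢ 0ℤ → p z ∧ adj? _≟_ θ (κ z) a ≡ p z
      same z wz≢0 with p z in pz
      ... | false = refl
      ... | true with κ z ≟ a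
      ...   | yes κz≡a = ⊥-elim (off-color z pz κz≡a)
      ...   | no  κz≢a with θ-offdiag κz≢a
      ...     | inj₁ θ≡-1 rewrite θ≡-1 = refl
      ...     | inj₂ θ≡0  = ⊥-elim (wz≢0 (cong -_ θ≡0))

    TopOfColor BottomOfColor : Fin n → Set
    TopOfColor    x = ∀ z → κ z ≡ κ x → lt P x z ≡ false
    BottomOfColor y = ∀ z → κ z ≡ κ y → lt P z y ≡ false

    top⇒MaxOfColor : ∀ x → TopOfColor x → MaxOfColor P x
    top⇒MaxOfColor x top y κy≡κx x≤y = case ≤⇒≡⊎< P x≤y of λ where
      (inj₁ x≡y) → sym x≡y
      (inj₂ x<y) → ⊥-elim (true≢false (trans (sym x<y) (top y κy≡κx)))

    MaxOfColor⇒top : ∀ x → MaxOfColor P x → TopOfColor x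
    MaxOfColor⇒top x x-max z κz≡κx =
      ¬-not (λ x<z → <⇒≢ P x<z (sym (x-max z κz≡κx (<⇒≤ P x<z))))

    bottom⇒MinOfColor : ∀ y → BottomOfColor y → MinOfColor P y
    bottom⇒MinOfColor y bottom x κx≡κy x≤y = case ≤⇒≡⊎< P x≤y of λ where
      (inj₁ x≡y) → x≡y
      (inj₂ x<y) → ⊥-elim (true≢false (trans (sym x<y) (bottom x κx≡κy)))

    sum-above-top : ∀ x → TopOfColor x → sum (↑ x ◃ wt (κ x)) ≤ 1ℤ
    sum-above-top x top =
      subst (_≤ 1ℤ) (sumWhere-adj (lt P x) (κ x) off-color) (UCB1 x (top⇒MaxOfColor x top))
      where
      off-color : ∀ z → lt P x z ≡ true → κ z ≢ κ x
      off-color z x<z κz≡κx = true≢false (trans (sym x<z) (top z κz≡κx))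

    sum-below-bottom : ∀ y → BottomOfColor y → sum (↓ y ◃ wt (κ y)) ≤ 1ℤ
    sum-below-bottom y bottom = subst (_≤ 1ℤ) (sumWhere-adj (↓ y) (κ y) off-color)
                                      (LCB1 y (bottom⇒MinOfColor y bottom))
      where
      off-color : ∀ z → lt P z y ≡ true → κ z ≢ κ y
      off-color z z<y κz≡κy = true≢false (trans (sym z<y) (bottom z κz≡κy))

    sum-between : ∀ {x y} → Consecutive P x y → sum ((λ z → ↑ x z ∧ ↓ y z) ◃ wt (κ y)) ≡ + 2
    sum-between {x} {y} xy@(_ , κx≡κy , _) =
      trans (cong (λ a → sum ((λ z → ↑ x z ∧ ↓ y z) ◃ wt a)) (sym κx≡κy))
            (trans (sym (sumWhere≡sum _ (wt (κ x)))) (ICE2 x y xy))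

    weight-above-top : ∀ x → TopOfColor x → weight (↑ x) (κ x) ≡ 1ℤ
    weight-above-top x top with κ x ≟ root
    ... | yes κx≡root = cong (_+_ 1ℤ) (sum-zero λ z → ◃-false (↑ x) (wt (κ x))
                          (subst (λ w → lt P w z ≡ false) (sym x≡root) (nothing-above-root z)))
      where
      x≡root : x ≡ f root
      x≡root = trans (top-unique x (top⇒MaxOfColor x top)) (cong f κx≡root)
    ... | no  κx≢root = trans (ℤP.+-identityˡ _) (ℤP.≤-antisym (sum-above-top x top) parent-term)
      where
      x≡top : x ≡ f (κ x)
      x≡top = top-unique x (top⇒MaxOfColor x top)
      b = proj₁ (parent (κ x) κx≢root)
      κx≤b = proj₁ (proj₂ (parent (κ x) κx≢root))
      θb≡-1 = proj₂ (proj₂ (parent (κ x) κx≢root))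
      x≢fb : x ≢ f b
      x≢fb x≡fb with () ← trans (sym θb≡-1)
        (trans (cong (λ c → θ b c) (trans (cong κ x≡fb) (f-col b))) (θ-diag b))
      x<fb : lt P x (f b) ≡ true
      x<fb = ≤∧≢⇒< P (subst (λ w → le w (f b) ≡ true) (sym x≡top) (f-mono κx≤b)) x≢fb
      wt-fb : (↑ x ◃ wt (κ x)) (f b) ≡ 1ℤ
      wt-fb = trans (◃-true (↑ x) (wt (κ x)) x<fb)
                    (cong -_ (trans (cong (λ c → θ c (κ x)) (f-col b)) θb≡-1))
      parent-term : 1ℤ ≤ sum (↑ x ◃ wt (κ x))
      parent-term = subst (_≤ sum (↑ x ◃ wt (κ x))) wt-fb
        (term≤sum (◃-nonneg (↑ x) λ z x<z → wt-nonneg λ κz≡κx →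
          true≢false (trans (sym x<z) (top z κz≡κx))) (f b))

    weight-above-step : ∀ {x x'} → Consecutive P x x' → weight (↑ x') (κ x') ≡ 1ℤ →
                        weight (↑ x) (κ x) ≡ 1ℤ
    weight-above-step {x} {x'} xx'@(x<x' , κx≡κx' , _) above'≡1 = begin
      weight (↑ x) (κ x)                              ≡⟨ cong (weight (↑ x)) κx≡κx' ⟩
      weight (↑ x) (κ x')                             ≡⟨ weight-split (↑ x) x' above'≡1 x<x'
                                                           (λ z x'<z → <-trans P x<x' x'<z) ⟩
      -1ℤ + sum ((λ z → ↑ x z ∧ ↓ x' z) ◃ wt (κ x'))  ≡⟨ cong (_+_ -1ℤ) (sum-between xx') ⟩
      1ℤ                                              ∎
      where open ≡-Reasoning

    weight-above : ∀ x → weight (↑ x) (κ x) ≡ 1ℤ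
    weight-above x = induct (Above.≺-wellFounded x)
      where
      induct : ∀ {x} → Acc Above._≺_ x → weight (↑ x) (κ x) ≡ 1ℤ
      induct {x} (acc rs) with any? (λ z → (κ z ≟ κ x) ×-dec (lt P x z ≟ᵇ true))
      ... | no none = weight-above-top x λ z κz≡κx → ¬-not (λ x<z → none (z , κz≡κx , x<z))
      ... | yes (_ , above) with Below.minimal (λ z → (κ z ≟ κ x) ×-dec (lt P x z ≟ᵇ true)) above
      ...   | x' , (κx'≡κx , x<x') , least = weight-above-step consecutive (induct (rs x<x'))
        where
        consecutive : Consecutive P x x'
        consecutive = x<x' , sym κx'≡κx , λ z κz≡κx (x<z , z<x') →
          true≢false (trans (sym z<x') (least z (κz≡κx , x<z)))

    UpClosed : (Fin n → Bool) → Set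
    UpClosed U = ∀ x y → U x ≡ true → le x y ≡ true → U y ≡ true

    weight-frontier : ∀ {U} x → UpClosed U → U x ≡ false → (∀ z → lt P x z ≡ true → U z ≡ true) →
                      weight U (κ x) ≡ 1ℤ
    weight-frontier {U} x U-up x∉U above⊆U =
      trans (cong (_+_ (ω (κ x))) (◃-cong-support (wt (κ x)) same)) (weight-above x)
      where
      same : ∀ z → wt (κ x) z ≢ 0ℤ → U z ≡ lt P x z
      same z wz≢0 with wt-support x z
      ... | inj₁ wz≡0               = ⊥-elim (wz≢0 wz≡0)
      ... | inj₂ (inj₁ refl)        = trans x∉U (sym (<-irrefl P x))
      ... | inj₂ (inj₂ (inj₂ x<z))  = trans (above⊆U z x<z) (sym x<z)
      ... | inj₂ (inj₂ (inj₁ z<x))  = trans (¬-not z∉U) (sym (<-asym P z<x))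
        where
        z∉U : U z ≢ true
        z∉U z∈U = true≢false (trans (sym (U-up z x z∈U (<⇒≤ P z<x))) x∉U)

    weight-bounds-absent : ∀ {U} → UpClosed U → ∀ x → TopOfColor x →
      (∀ z → U z ≡ true → κ z ≢ κ x) → -1ℤ ≤ weight U (κ x) × weight U (κ x) ≤ 1ℤ
    weight-bounds-absent {U} U-up x top off-color = lower , upper
      where
      a = κ x
      lower : -1ℤ ≤ weight U a
      lower = ℤP.≤-trans -≤+ (ℤP.+-mono-≤ (ω-nonneg a)
                (sum-nonneg (◃-nonneg U λ z z∈U → wt-nonneg (off-color z z∈U))))
      U⊆above : ∀ z → wt a z ≢ 0ℤ → U z ≡ true → lt P x z ≡ true
      U⊆above z wz≢0 z∈U with wt-support x z
      ... | inj₁ wz≡0              = ⊥-elim (wz≢0 wz≡0)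
      ... | inj₂ (inj₁ refl)       = ⊥-elim (off-color x z∈U refl)
      ... | inj₂ (inj₂ (inj₁ z<x)) = ⊥-elim (off-color x (U-up z x z∈U (<⇒≤ P z<x)) refl)
      ... | inj₂ (inj₂ (inj₂ x<z)) = x<z
      upper : weight U a ≤ 1ℤ
      upper = subst (weight U a ≤_) (weight-above x) (ℤP.+-monoʳ-≤ (ω a)
        (◃-mono-support (wt a) U⊆above λ z x<z →
          wt-nonneg λ κz≡κx → true≢false (trans (sym x<z) (top z κz≡κx))))

    sum-below-least≤2 : ∀ {U} → UpClosed U → ∀ y →
      (∀ z → U z ≡ true × κ z ≡ κ y → lt P z y ≡ false) →
      sum ((λ z → U z ∧ ↓ y z) ◃ wt (κ y)) ≤ + 2
    sum-below-least≤2 {U} U-up y least with any? (λ z → (κ z ≟ κ y) ×-dec (lt P z y ≟ᵇ true))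
    ... | no none = ℤP.≤-trans (◃-mono-support (wt (κ y)) (λ z _ → proj₂ ∘ ∧-true⁻ {U z}) nonneg)
                               (ℤP.≤-trans (sum-below-bottom y bottom) (+≤+ (s≤s z≤n)))
      where
      bottom : BottomOfColor y
      bottom z κz≡κy = ¬-not λ z<y → none (z , κz≡κy , z<y)
      nonneg : ∀ z → lt P z y ≡ true → 0ℤ ≤ wt (κ y) z
      nonneg z z<y = wt-nonneg λ κz≡κy → true≢false (trans (sym z<y) (bottom z κz≡κy))
    ... | yes (_ , below) with Above.minimal (λ z → (κ z ≟ κ y) ×-dec (lt P z y ≟ᵇ true)) below
    ...   | x , (κx≡κy , x<y) , greatest =
      subst (sum ((λ z → U z ∧ ↓ y z) ◃ wt (κ y)) ≤_) (sum-between consecutive)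
            (◃-mono-support (wt (κ y)) inside-between nonneg)
      where
      consecutive : Consecutive P x y
      consecutive = x<y , κx≡κy , λ z κz≡κx (x<z , z<y) →
        true≢false (trans (sym x<z) (greatest z (trans κz≡κx κx≡κy , z<y)))
      x∉U : U x ≢ true
      x∉U x∈U = true≢false (trans (sym x<y) (least x (x∈U , κx≡κy)))
      inside-between : ∀ z → wt (κ y) z ≢ 0ℤ → U z ∧ lt P z y ≡ true → lt P x z ∧ lt P z y ≡ true
      inside-between z wz≢0 z∈U∧z<y with ∧-true⁻ z∈U∧z<y | wt-support x z
      ... | _ , _ | inj₁ wz≡0 = ⊥-elim (wz≢0 (trans (cong (λ a → wt a z) (sym κx≡κy)) wz≡0))
      ... | z∈U , _ | inj₂ (inj₁ refl) = ⊥-elim (x∉U z∈U)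
      ... | z∈U , _ | inj₂ (inj₂ (inj₁ z<x)) = ⊥-elim (x∉U (U-up z x z∈U (<⇒≤ P z<x)))
      ... | _ , z<y | inj₂ (inj₂ (inj₂ x<z)) = ∧-true⁺ x<z z<y
      nonneg : ∀ z → lt P x z ∧ lt P z y ≡ true → 0ℤ ≤ wt (κ y) z
      nonneg z x<z∧z<y = wt-nonneg λ κz≡κy →
        proj₂ (proj₂ consecutive) z (trans κz≡κy (sym κx≡κy)) (∧-true⁻ x<z∧z<y)

    weight-bounds-present : ∀ {U} → UpClosed U → ∀ y → U y ≡ true →
      (∀ z → U z ≡ true × κ z ≡ κ y → lt P z y ≡ false) → -1ℤ ≤ weight U (κ y) × weight U (κ y) ≤ 1ℤ
    weight-bounds-present {U} U-up y y∈U least =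
      subst (-1ℤ ≤_) (sym split) (ℤP.+-monoʳ-≤ -1ℤ (sum-nonneg (◃-nonneg _ nonneg))) ,
      subst (_≤ 1ℤ) (sym split) (ℤP.+-monoʳ-≤ -1ℤ (sum-below-least≤2 U-up y least))
      where
      split : weight U (κ y) ≡ -1ℤ + sum ((λ z → U z ∧ ↓ y z) ◃ wt (κ y))
      split = weight-split U y (weight-above y) y∈U (λ z y<z → U-up y z y∈U (<⇒≤ P y<z))
      nonneg : ∀ z → U z ∧ lt P z y ≡ true → 0ℤ ≤ wt (κ y) z
      nonneg z z∈U∧z<y with ∧-true⁻ z∈U∧z<y
      ... | z∈U , z<y = wt-nonneg λ κz≡κy → true≢false (trans (sym z<y) (least z (z∈U , κz≡κy)))

    weight-bounds : ∀ {U} → UpClosed U → ∀ a → -1ℤ ≤ weight U a × weight U a ≤ 1ℤ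
    weight-bounds {U} U-up a with any? (λ z → (U z ≟ᵇ true) ×-dec (κ z ≟ a))
    ... | no none = subst (λ b → -1ℤ ≤ weight U b × weight U b ≤ 1ℤ) (f-col a)
      (weight-bounds-absent U-up (f a) (MaxOfColor⇒top (f a) (f-top a))
        λ z z∈U κz≡κfa → none (z , z∈U , trans κz≡κfa (f-col a)))
    ... | yes (_ , some) with Below.minimal (λ z → (U z ≟ᵇ true) ×-dec (κ z ≟ a)) some
    ...   | y , (y∈U , refl) , least = weight-bounds-present U-up y y∈U least

    weight-total≤0 : ∀ a → weight (λ _ → true) a ≤ 0ℤ
    weight-total≤0 a with κ-surj a
    ... | x , refl with Below.minimal (λ z → κ z ≟ κ x) refl
    ...   | y , κy≡κx , least = subst (λ b → weight (λ _ → true) b ≤ 0ℤ) κy≡κx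
      (subst (_≤ 0ℤ) (sym (weight-split (λ _ → true) y (weight-above y) refl (λ _ _ → refl)))
        (ℤP.+-monoʳ-≤ -1ℤ (sum-below-bottom y λ z κz≡κy → least z (trans κz≡κy κy≡κx))))

    module _ {m : ℕ} (S : Fin m → C × ℕ) where

      pairing-nonneg : (∀ i → 0ℤ ≤ pairing θ S (proj₁ (S i))) → ∀ c → 0ℤ ≤ pairing θ S c
      pairing-nonneg on-support c with any? (λ i → c ≟ proj₁ (S i))
      ... | yes (i , refl) = on-support i
      ... | no  off        = sum-nonneg λ i → *-nonneg (proj₂ (S i)) (-θ-nonneg λ c≡aᵢ → off (i , c≡aᵢ))

      weighted-total : sum (λ i → + proj₂ (S i) * weight (λ _ → true) (proj₁ (S i))) ≡
                       sum (λ i → + proj₂ (S i) * ω (proj₁ (S i))) + sum (λ z → pairing θ S (κ z))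
      weighted-total = begin
        sum (λ i → d i * (ω (a i) + sum (wt (a i))))
          ≡⟨ sum-cong-≗ (λ i → trans (ℤP.*-distribˡ-+ (d i) (ω (a i)) _)
                                     (cong (_+_ (d i * ω (a i))) (*-distribˡ-sum (d i) (wt (a i))))) ⟩
        sum (λ i → d i * ω (a i) + sum (λ z → d i * wt (a i) z))
          ≡⟨ ∑-distrib-+ (λ i → d i * ω (a i)) _ ⟩
        sum (λ i → d i * ω (a i)) + sum (λ i → sum (λ z → d i * wt (a i) z))
          ≡⟨ cong (_+_ (sum (λ i → d i * ω (a i)))) (∑-comm (λ i z → d i * wt (a i) z)) ⟩
        sum (λ i → d i * ω (a i)) + sum (λ z → pairing θ S (κ z))
          ∎
        where
        open ≡-Reasoning
        d : Fin m → ℤ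
        d i = + proj₂ (S i)
        a : Fin m → C
        a i = proj₁ (S i)

      affine-obstruction : (∀ i → 0ℤ ≤ pairing θ S (proj₁ (S i))) →
        (∃ λ i → proj₁ (S i) ≡ root × 0 ℕ.< proj₂ (S i)) ⊎ (∃ λ c → 0ℤ < pairing θ S c) → ⊥
      affine-obstruction on-support positive =
        ℤP.<⇒≱ (subst (0ℤ <_) (sym weighted-total) (total-pos positive)) total≤0
        where
        total≤0 : sum (λ i → + proj₂ (S i) * weight (λ _ → true) (proj₁ (S i))) ≤ 0ℤ
        total≤0 = sum-nonpos λ i → *-nonpos (proj₂ (S i)) (weight-total≤0 (proj₁ (S i)))
        root-nonneg : ∀ i → 0ℤ ≤ + proj₂ (S i) * ω (proj₁ (S i))
        root-nonneg i = *-nonneg (proj₂ (S i)) (ω-nonneg (proj₁ (S i)))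
        pairing-part : 0ℤ ≤ sum (λ z → pairing θ S (κ z))
        pairing-part = sum-nonneg λ z → pairing-nonneg on-support (κ z)
        total-pos : (∃ λ i → proj₁ (S i) ≡ root × 0 ℕ.< proj₂ (S i)) ⊎ (∃ λ c → 0ℤ < pairing θ S c) →
                    0ℤ < sum (λ i → + proj₂ (S i) * ω (proj₁ (S i))) + sum (λ z → pairing θ S (κ z))
        total-pos (inj₁ (i , aᵢ≡root , 0<dᵢ)) =
          ℤP.+-mono-<-≤ (ℤP.<-≤-trans root-term (term≤sum root-nonneg i)) pairing-part
          where
          root-term : 0ℤ < + proj₂ (S i) * ω (proj₁ (S i))
          root-term rewrite aᵢ≡root | ω-root = subst (0ℤ <_) (sym (ℤP.*-identityʳ _)) (+<+ 0<dᵢ)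
        total-pos (inj₂ (c , c-pos)) with κ-surj c
        ... | z , refl = ℤP.+-mono-≤-< (sum-nonneg root-nonneg)
                           (ℤP.<-≤-trans c-pos (term≤sum (λ z → pairing-nonneg on-support (κ z)) z))

    module _ (colors : List C) (complete : ∀ a → a ∈ colors) where
      open Exploration _≟_ θ colors complete

      encode-weight-empty : ∀ {U} → (∀ z → U z ≡ false) → encode (weight U) ≡ encode ω
      encode-weight-empty {U} empty = map-cong (λ a → trans
        (cong (_+_ (ω a)) (sum-zero λ z → ◃-false U (wt a) (empty z))) (ℤP.+-identityʳ (ω a))) colors

      module _ {U : Fin n → Bool} (U-up : UpClosed U) {y} (y∈U : U y ≡ true)
               (least : ∀ z → U z ≡ true → lt P z y ≡ false) where

        ∖-minimal-⊏ : (U ∖ y) ⊏ U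
        ∖-minimal-⊏ = ⊏-intro (λ z → proj₁ ∘ ∧-true⁻ {U z}) y y∈U (∖-self U y)

        ∖-minimal-up : UpClosed (U ∖ y)
        ∖-minimal-up x x' x∈U∖y x≤x' = trans (∖-other U x'≢y) (U-up x x' x∈U x≤x')
          where
          x∈U : U x ≡ true
          x∈U = proj₁ (∧-true⁻ {U x} x∈U∖y)
          x≢y : x ≢ y
          x≢y refl = true≢false (trans (sym x∈U∖y) (∖-self U y))
          x'≢y : x' ≢ y
          x'≢y refl = true≢false (trans (sym (≤∧≢⇒< P x≤x' x≢y)) (least x x∈U))

        weight-∖-minimal : weight (U ∖ y) (κ y) ≡ 1ℤ
        weight-∖-minimal = weight-frontier y ∖-minimal-up (∖-self U y) λ z y<z →
          trans (∖-other U (λ z≡y → <⇒≢ P y<z (sym z≡y))) (U-up y z y∈U (<⇒≤ P y<z))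

        encode-weight-∖ : encode (weight U) ≡ reflect (encode (weight (U ∖ y))) (κ y)
        encode-weight-∖ = trans (map-cong remove colors) (sym (reflect-encode (weight (U ∖ y)) (κ y)))
          where
          remove : ∀ b → weight U b ≡ weight (U ∖ y) b + - θ (κ y) b
          remove b = trans (cong (_+_ (ω b)) (sum-◃-∖ U (wt b) y∈U))
                           (sym (ℤP.+-assoc (ω b) (sum ((U ∖ y) ◃ wt b)) (wt b y)))

        reachable-∖-minimal : Reachable (encode ω) (encode (weight (U ∖ y))) →
                              Reachable (encode ω) (encode (weight U))
        reachable-∖-minimal reachable = subst (Reachable _) (sym encode-weight-∖)
          (reflect-at (κ y) reachable (trans (coord-encode _ (κ y)) weight-∖-minimal)
            (subst InRange encode-weight-∖ (encode-inRange (weight U) (weight-bounds U-up))))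

      filter-reachable : ∀ U → UpClosed U → Reachable (encode ω) (encode (weight U))
      filter-reachable U = induct (⊏-wellFounded U)
        where
        induct : ∀ {U} → Acc _⊏_ U → UpClosed U → Reachable (encode ω) (encode (weight U))
        induct {U} (acc rs) U-up with any? (λ z → U z ≟ᵇ true)
        ... | no empty =
          subst (Reachable _) (sym (encode-weight-empty λ z → ¬-not λ z∈U → empty (z , z∈U))) here
        ... | yes (_ , nonempty) with Below.minimal (λ z → U z ≟ᵇ true) nonempty
        ...   | y , y∈U , least = reachable-∖-minimal U-up y∈U least
          (induct (rs (∖-minimal-⊏ U-up y∈U least)) (∖-minimal-up U-up y∈U least))

      exploration-obstruction : ∀ f → Explored f (encode ω ∷ []) → ⊥
      exploration-obstruction f explored = encode-nonpos (weight (λ _ → true)) weight-total≤0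
        (reachable-positive explored (filter-reachable (λ _ → true) (λ _ _ _ _ → refl)))

open Weights

module TreeY where

  open import Data.Nat using (ℕ; zero; suc; _≡ᵇ_)
  open import Data.Fin using (Fin; zero; suc; toℕ; inject₁; fromℕ)
  open import Data.Fin.Properties using (toℕ-inject₁; toℕ-fromℕ)
  open import Data.Fin.Induction using (<-weakInduction)
  open import Data.Integer using (+_; 0ℤ; -1ℤ)
  open import Data.Bool using (true; false; _∨_)
  open import Data.List using (List; []; _∷_; map; allFin; _++_)
  open import Data.List.Membership.Propositional using (_∈_)
  open import Data.List.Membership.Propositional.Properties using (∈-map⁺; ∈-++⁺ˡ; ∈-++⁺ʳ; ∈-allFin)
  open import Data.Product using (∃; _×_; _,_)
  open import Data.Sum using (_⊎_; inj₁; inj₂)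
  open import Data.Empty using (⊥-elim)
  open import Relation.Binary.Construct.Closure.ReflexiveTransitive using (ε; _◅_)
  open import Relation.Nullary using (¬_; Dec; yes; no)
  open import Relation.Nullary.Decidable using (True; toWitness)
  open import Relation.Binary.PropositionalEquality

  ≡ᵇ-refl : ∀ m → (m ≡ᵇ m) ≡ true
  ≡ᵇ-refl zero    = refl
  ≡ᵇ-refl (suc m) = ≡ᵇ-refl m

  suc-≡ᵇ : ∀ m → (suc m ≡ᵇ m) ≡ false
  suc-≡ᵇ zero    = refl
  suc-≡ᵇ (suc m) = suc-≡ᵇ m

  module _ {i j k : ℕ} where

    θY-diag : ∀ (a : Node i j k) → θY a a ≡ + 2
    θY-diag a with a ≟N a
    ... | yes _   = refl
    ... | no  a≢a = ⊥-elim (a≢a refl)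

    θY-offdiag : ∀ {a b : Node i j k} → a ≢ b → θY a b ≡ -1ℤ ⊎ θY a b ≡ 0ℤ
    θY-offdiag {a} {b} a≢b with a ≟N b
    ... | yes a≡b = ⊥-elim (a≢b a≡b)
    ... | no  _ with coversY a b ∨ coversY b a
    ...   | true  = inj₁ refl
    ...   | false = inj₂ refl

    covers-irrefl : ∀ (a : Node i j k) → coversY a a ≡ false
    covers-irrefl (t m) = suc-≡ᵇ (toℕ m)
    covers-irrefl (u m) = suc-≡ᵇ (toℕ m)
    covers-irrefl (v m) = suc-≡ᵇ (toℕ m)

    θY-covers : ∀ {a b : Node i j k} → coversY b a ≡ true → θY b a ≡ -1ℤ
    θY-covers {a} {b} b⋗a with b ≟N a
    ... | yes refl with () ← trans (sym b⋗a) (covers-irrefl a)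
    ... | no  _ rewrite b⋗a = refl

  Root : ∀ {i j k} → Node (suc i) j k
  Root = t zero

  covers-t : ∀ {i j k} (m : Fin i) → coversY {suc i} {j} {k} (t (inject₁ m)) (t (suc m)) ≡ true
  covers-t m rewrite toℕ-inject₁ m = ≡ᵇ-refl (toℕ m)

  covers-u₀ : ∀ {i j k} → coversY {suc i} {suc j} {k} (t (fromℕ i)) (u zero) ≡ true
  covers-u₀ {i} rewrite toℕ-fromℕ i | ≡ᵇ-refl i = refl

  covers-v₀ : ∀ {i j k} → coversY {suc i} {j} {suc k} (t (fromℕ i)) (v zero) ≡ true
  covers-v₀ {i} rewrite toℕ-fromℕ i | ≡ᵇ-refl i = refl

  covers-u : ∀ {i j k} (m : Fin j) → coversY {i} {suc j} {k} (u (inject₁ m)) (u (suc m)) ≡ true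
  covers-u m rewrite toℕ-inject₁ m = ≡ᵇ-refl (toℕ m)

  covers-v : ∀ {i j k} (m : Fin k) → coversY {i} {j} {suc k} (v (inject₁ m)) (v (suc m)) ≡ true
  covers-v m rewrite toℕ-inject₁ m = ≡ᵇ-refl (toℕ m)

  upper-cover : ∀ {i j k} (a : Node (suc i) j k) → a ≢ Root → ∃ λ b → coversY b a ≡ true
  upper-cover (t zero)    t₀≢root = ⊥-elim (t₀≢root refl)
  upper-cover {i} {j} {k} (t (suc m)) _ = t (inject₁ m) , covers-t {j = j} {k} m
  upper-cover {i} {suc j} {k} (u zero) _ = t (fromℕ i) , covers-u₀ {i} {j} {k}
  upper-cover {i} {suc j} {k} (u (suc m)) _ = u (inject₁ m) , covers-u {suc i} {k = k} m
  upper-cover {i} {j} {suc k} (v zero) _ = t (fromℕ i) , covers-v₀ {i} {j} {k}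
  upper-cover {i} {j} {suc k} (v (suc m)) _ = v (inject₁ m) , covers-v {suc i} {j} m

  parent : ∀ {i j k} (a : Node (suc i) j k) → a ≢ Root → ∃ λ b → a ≤Y b × θY b a ≡ -1ℤ
  parent a a≢root with upper-cover a a≢root
  ... | b , b⋗a = b , b⋗a ◅ ε , θY-covers {a = a} {b} b⋗a

  ≤Y-root : ∀ {i j k} (a : Node (suc i) j k) → a ≤Y Root
  ≤Y-root {i} {j} {k} (t m) =
    <-weakInduction (λ m → t m ≤Y Root) ε (λ m tm≤root → covers-t {j = j} {k} m ◅ tm≤root) m
  ≤Y-root {i} {suc j} {k} (u m) = <-weakInduction (λ m → u m ≤Y Root)
    (covers-u₀ {i} {j} {k} ◅ ≤Y-root (t (fromℕ i)))
    (λ m um≤root → covers-u {suc i} {k = k} m ◅ um≤root) m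
  ≤Y-root {i} {j} {suc k} (v m) = <-weakInduction (λ m → v m ≤Y Root)
    (covers-v₀ {i} {j} {k} ◅ ≤Y-root (t (fromℕ i)))
    (λ m vm≤root → covers-v {suc i} {j} m ◅ vm≤root) m

  allNodes : ∀ i j k → List (Node i j k)
  allNodes i j k = map t (allFin i) ++ map u (allFin j) ++ map v (allFin k)

  allNodes-complete : ∀ {i j k} (a : Node i j k) → a ∈ allNodes i j k
  allNodes-complete (t m) = ∈-++⁺ˡ (∈-map⁺ t (∈-allFin m))
  allNodes-complete {i} (u m) = ∈-++⁺ʳ (map t (allFin i)) (∈-++⁺ˡ (∈-map⁺ u (∈-allFin m)))
  allNodes-complete {i} {j} (v m) =
    ∈-++⁺ʳ (map t (allFin i)) (∈-++⁺ʳ (map u (allFin j)) (∈-map⁺ v (∈-allFin m)))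

  module ExplorationY (i j k : ℕ) =
    Exploration _≟N_ (θY {suc i} {j} {k}) (allNodes (suc i) j k) allNodes-complete

  OrbitExplored : ℕ → ℕ → ℕ → ℕ → Set
  OrbitExplored i j k f = Explored f (encode (fundamental _≟N_ Root) ∷ [])
    where open ExplorationY i j k

  orbitExplored? : ∀ i j k f → Dec (OrbitExplored i j k f)
  orbitExplored? i j k f = explored? f (encode (fundamental _≟N_ Root) ∷ [])
    where open ExplorationY i j k

  module MinusculeY {i j k n} (P : ColoredPoset (Node (suc i) j k) n)
    (M : IsMinuscule P _≟N_ θY) (H : HasTopTree P _≟N_ θY _≤Y_) =
    MinusculeWeights _≟N_ θY θY-diag θY-offdiag _≤Y_ Root ≤Y-root parent P M H

  excluded-by-exploration : ∀ {i j k} f → True (orbitExplored? i j k f) →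
    ∀ n (P : ColoredPoset (Node (suc i) j k) n) → ¬ MinusculeWithTopTreeY (suc i) j k n P
  excluded-by-exploration f explored n P (M , H) =
    MinusculeY.exploration-obstruction P M H (allNodes _ _ _) allNodes-complete f (toWitness explored)

open TreeY

module AffineCodes where

  open import Data.Nat as ℕ using (ℕ; suc; _+_; _⊓_; _≡ᵇ_; s≤s)
  import Data.Nat.Properties as ℕP
  open import Data.Fin using (Fin; toℕ; fromℕ<)
  open import Data.Fin.Properties using (toℕ-fromℕ<; toℕ-injective) renaming (_≟_ to _≟F_)
  open import Data.Integer using (ℤ; +_; -_; 0ℤ; -1ℤ; _*_; _≤_; _<_; _≤?_; _<?_)
  open import Data.Bool using (Bool; true; false; _∧_; _∨_; if_then_else_) renaming (T to Tᵇ)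
  open import Data.Bool.Properties using (∨-identityʳ)
  open import Data.Product using (_×_; _,_; proj₁; proj₂)
  open import Data.Empty using (⊥-elim)
  open import Relation.Nullary using (¬_; Dec; yes; no)
  open import Relation.Nullary.Decidable using (True; toWitness; _×-dec_)
  open import Data.Fin.Properties using (all?; any?)
  open import Data.Sum using (inj₁; inj₂)
  open import Relation.Binary.PropositionalEquality

  θPath : ℕ → ℕ → ℤ
  θPath p q = if p ≡ᵇ q then + 2 else if (suc p ≡ᵇ q) ∨ (suc q ≡ᵇ p) then -1ℤ else 0ℤ

  ≡ᵇ-+ʳ : ∀ p q x → (p + x ≡ᵇ q + x) ≡ (p ≡ᵇ q)
  ≡ᵇ-+ʳ p q x with p ≡ᵇ q in p≡ᵇq | p + x ≡ᵇ q + x in p+x≡ᵇq+x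
  ... | true  | true  = refl
  ... | false | false = refl
  ... | true  | false rewrite ℕP.≡ᵇ⇒≡ p q (subst Tᵇ (sym p≡ᵇq) _) | ≡ᵇ-refl (q + x) = sym p+x≡ᵇq+x
  ... | false | true  rewrite ℕP.+-cancelʳ-≡ x p q (ℕP.≡ᵇ⇒≡ (p + x) (q + x) (subst Tᵇ (sym p+x≡ᵇq+x) _))
                            | ≡ᵇ-refl q = p≡ᵇq

  ≡ᵇ-false : ∀ {p q} → p ≢ q → (p ≡ᵇ q) ≡ false
  ≡ᵇ-false {p} {q} p≢q with p ≡ᵇ q in p≡ᵇq
  ... | true  = ⊥-elim (p≢q (ℕP.≡ᵇ⇒≡ p q (subst Tᵇ (sym p≡ᵇq) _)))
  ... | false = refl

  θPath-+ʳ : ∀ p q x → θPath (p + x) (q + x) ≡ θPath p q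
  θPath-+ʳ p q x rewrite ≡ᵇ-+ʳ p q x | ≡ᵇ-+ʳ (suc p) q x | ≡ᵇ-+ʳ (suc q) p x = refl

  module _ {i j k : ℕ} where

    θY-t : ∀ (m m' : Fin i) → θY {i} {j} {k} (t m) (t m') ≡ θPath (toℕ m) (toℕ m')
    θY-t m m' with m ≟F m'
    ... | yes refl rewrite ≡ᵇ-refl (toℕ m) = refl
    ... | no  m≢m' rewrite ≡ᵇ-false (λ e → m≢m' (toℕ-injective e)) = refl

    θY-u : ∀ (m m' : Fin j) → θY {i} {j} {k} (u m) (u m') ≡ θPath (toℕ m) (toℕ m')
    θY-u m m' with m ≟F m'
    ... | yes refl rewrite ≡ᵇ-refl (toℕ m) = refl
    ... | no  m≢m' rewrite ≡ᵇ-false (λ e → m≢m' (toℕ-injective e)) = refl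

    θY-v : ∀ (m m' : Fin k) → θY {i} {j} {k} (v m) (v m') ≡ θPath (toℕ m) (toℕ m')
    θY-v m m' with m ≟F m'
    ... | yes refl rewrite ≡ᵇ-refl (toℕ m) = refl
    ... | no  m≢m' rewrite ≡ᵇ-false (λ e → m≢m' (toℕ-injective e)) = refl

  data Code : Set where
    T U V : ℕ → Code

  -- Y(1+D+x; 1+J+y; 1+K+z) seen from its branch point: T a is t_{x + min(a,D) + 1}, so T D is the
  -- branch node, and U b, V b are u_{min(b,J) + 1}, v_{min(b,K) + 1}.  Since θᶜ does not involve
  -- the offsets x, y, z, the certificates below are decided by evaluation for all of them at once.
  module Shape (D x J y K z : ℕ) where

    Nd : Set
    Nd = Node (suc (D + x)) (suc (J + y)) (suc (K + z))

    tIdx : ℕ → Fin (suc (D + x))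
    tIdx a = fromℕ< (s≤s (ℕP.+-monoˡ-≤ x (ℕP.m⊓n≤n a D)))

    uIdx : ℕ → Fin (suc (J + y))
    uIdx b = fromℕ< (s≤s (ℕP.≤-trans (ℕP.m⊓n≤n b J) (ℕP.m≤m+n J y)))

    vIdx : ℕ → Fin (suc (K + z))
    vIdx b = fromℕ< (s≤s (ℕP.≤-trans (ℕP.m⊓n≤n b K) (ℕP.m≤m+n K z)))

    toℕ-tIdx : ∀ a → toℕ (tIdx a) ≡ (a ⊓ D) + x
    toℕ-tIdx a = toℕ-fromℕ< (s≤s (ℕP.+-monoˡ-≤ x (ℕP.m⊓n≤n a D)))

    toℕ-uIdx : ∀ b → toℕ (uIdx b) ≡ b ⊓ J
    toℕ-uIdx b = toℕ-fromℕ< (s≤s (ℕP.≤-trans (ℕP.m⊓n≤n b J) (ℕP.m≤m+n J y)))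

    toℕ-vIdx : ∀ b → toℕ (vIdx b) ≡ b ⊓ K
    toℕ-vIdx b = toℕ-fromℕ< (s≤s (ℕP.≤-trans (ℕP.m⊓n≤n b K) (ℕP.m≤m+n K z)))

    node : Code → Nd
    node (T a) = t (tIdx a)
    node (U b) = u (uIdx b)
    node (V b) = v (vIdx b)

    attached : ℕ → ℕ → Bool
    attached a b = ((a ⊓ D) ≡ᵇ D) ∧ (b ≡ᵇ 0)

    θᶜ : Code → Code → ℤ
    θᶜ (T a) (T a') = θPath (a ⊓ D) (a' ⊓ D)
    θᶜ (U b) (U b') = θPath (b ⊓ J) (b' ⊓ J)
    θᶜ (V b) (V b') = θPath (b ⊓ K) (b' ⊓ K)
    θᶜ (T a) (U b)  = if attached a (b ⊓ J) then -1ℤ else 0ℤ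
    θᶜ (U b) (T a)  = if attached a (b ⊓ J) then -1ℤ else 0ℤ
    θᶜ (T a) (V b)  = if attached a (b ⊓ K) then -1ℤ else 0ℤ
    θᶜ (V b) (T a)  = if attached a (b ⊓ K) then -1ℤ else 0ℤ
    θᶜ (U _) (V _)  = 0ℤ
    θᶜ (V _) (U _)  = 0ℤ

    θY-node : ∀ c c' → θY (node c) (node c') ≡ θᶜ c c'
    θY-node (T a) (T a') = trans (θY-t (tIdx a) (tIdx a'))
      (trans (cong₂ θPath (toℕ-tIdx a) (toℕ-tIdx a')) (θPath-+ʳ (a ⊓ D) (a' ⊓ D) x))
    θY-node (U b) (U b') = trans (θY-u (uIdx b) (uIdx b')) (cong₂ θPath (toℕ-uIdx b) (toℕ-uIdx b'))
    θY-node (V b) (V b') = trans (θY-v (vIdx b) (vIdx b')) (cong₂ θPath (toℕ-vIdx b) (toℕ-vIdx b'))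
    θY-node (T a) (U b) rewrite toℕ-tIdx a | toℕ-uIdx b | ≡ᵇ-+ʳ (a ⊓ D) D x =
      cong (λ c → if c then -1ℤ else 0ℤ) (∨-identityʳ _)
    θY-node (U b) (T a) rewrite toℕ-tIdx a | toℕ-uIdx b | ≡ᵇ-+ʳ (a ⊓ D) D x = refl
    θY-node (T a) (V b) rewrite toℕ-tIdx a | toℕ-vIdx b | ≡ᵇ-+ʳ (a ⊓ D) D x =
      cong (λ c → if c then -1ℤ else 0ℤ) (∨-identityʳ _)
    θY-node (V b) (T a) rewrite toℕ-tIdx a | toℕ-vIdx b | ≡ᵇ-+ʳ (a ⊓ D) D x = refl
    θY-node (U b) (V b') = refl
    θY-node (V b) (U b') = refl

    module _ {m : ℕ} (S : Fin m → Code × ℕ) where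

      labels : Fin m → Nd × ℕ
      labels i = node (proj₁ (S i)) , proj₂ (S i)

      pairing-node : ∀ c → pairing θY labels (node c) ≡ pairing θᶜ S c
      pairing-node c = sum-cong-≗ λ i → cong (λ θ → + proj₂ (S i) * - θ) (θY-node c (proj₁ (S i)))

      NonnegOnSupport? : Dec (∀ i → 0ℤ ≤ pairing θᶜ S (proj₁ (S i)))
      NonnegOnSupport? = all? λ i → 0ℤ ≤? pairing θᶜ S (proj₁ (S i))

      nonneg-on-support : True NonnegOnSupport? → ∀ i → 0ℤ ≤ pairing θY labels (proj₁ (labels i))
      nonneg-on-support certificate i =
        subst (0ℤ ≤_) (sym (pairing-node (proj₁ (S i)))) (toWitness certificate i)

      excluded-through-root : True NonnegOnSupport? →
        True (any? λ i → (node (proj₁ (S i)) ≟N Root) ×-dec (0 ℕ.<? proj₂ (S i))) →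
        ∀ n (P : ColoredPoset Nd n) → ¬ MinusculeWithTopTreeY _ _ _ n P
      excluded-through-root nonneg root-in-support n P (M , H) =
        MinusculeY.affine-obstruction P M H labels (nonneg-on-support nonneg)
          (inj₁ (toWitness root-in-support))

      excluded-with-neighbour : True NonnegOnSupport? → ∀ c → True (0ℤ <? pairing θᶜ S c) →
        ∀ n (P : ColoredPoset Nd n) → ¬ MinusculeWithTopTreeY _ _ _ n P
      excluded-with-neighbour nonneg c c-pos n P (M , H) =
        MinusculeY.affine-obstruction P M H labels (nonneg-on-support nonneg)
          (inj₂ (node c , subst (0ℤ <_) (sym (pairing-node c)) (toWitness c-pos)))

open AffineCodes

open import Data.Nat using (ℕ; zero; suc; _+_; _≤_; _<_; s≤s)
open import Data.Product using (_×_; _,_)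
open import Data.Sum using (_⊎_; inj₁; inj₂)
open import Data.Vec using (Vec; []; _∷_; lookup; map)
open import Data.Unit using (tt)
open import Relation.Nullary using (¬_)
open import Relation.Binary.PropositionalEquality using (_≡_; refl)

-- Null vectors of affine diagrams inside Y; lowered moves the T-labels one step towards the
-- branch point, which frees T 0 to be a neighbour of the support.
lowered : Code × ℕ → Code × ℕ
lowered (T a , d) = T (suc a) , d
lowered c         = c

Ẽ₆ : Vec (Code × ℕ) 7
Ẽ₆ = (T 2 , 3) ∷ (T 1 , 2) ∷ (T 0 , 1) ∷ (U 0 , 2) ∷ (U 1 , 1) ∷ (V 0 , 2) ∷ (V 1 , 1) ∷ []

Ẽ₇ : Vec (Code × ℕ) 8
Ẽ₇ = (T 1 , 4) ∷ (T 0 , 2) ∷ (U 0 , 3) ∷ (U 1 , 2) ∷ (U 2 , 1) ∷ (V 0 , 3) ∷ (V 1 , 2) ∷ (V 2 , 1) ∷ []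

Ẽ₇′ : Vec (Code × ℕ) 8
Ẽ₇′ = (T 3 , 4) ∷ (T 2 , 3) ∷ (T 1 , 2) ∷ (T 0 , 1) ∷ (U 0 , 2) ∷ (V 0 , 3) ∷ (V 1 , 2) ∷ (V 2 , 1) ∷ []

Ẽ₈ : Vec (Code × ℕ) 9
Ẽ₈ = (T 1 , 6) ∷ (T 0 , 3) ∷ (U 0 , 4) ∷ (U 1 , 2) ∷
     (V 0 , 5) ∷ (V 1 , 4) ∷ (V 2 , 3) ∷ (V 3 , 2) ∷ (V 4 , 1) ∷ []

Ẽ₈′ : Vec (Code × ℕ) 9
Ẽ₈′ = (T 2 , 6) ∷ (T 1 , 4) ∷ (T 0 , 2) ∷ (U 0 , 3) ∷
      (V 0 , 5) ∷ (V 1 , 4) ∷ (V 2 , 3) ∷ (V 3 , 2) ∷ (V 4 , 1) ∷ []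

Ẽ₈″ : Vec (Code × ℕ) 9
Ẽ₈″ = (T 5 , 6) ∷ (T 4 , 5) ∷ (T 3 , 4) ∷ (T 2 , 3) ∷ (T 1 , 2) ∷ (T 0 , 1) ∷
      (U 0 , 3) ∷ (V 0 , 4) ∷ (V 1 , 2) ∷ []

data Excluded : ℕ → ℕ → ℕ → Set where
  ⊇Ẽ₆  : ∀ x y z → Excluded (3 + x) (2 + y) (2 + z)
  ⊇Ẽ₇  : ∀ y z   → Excluded 2 (3 + y) (3 + z)
  ⊇Ẽ₇′ : ∀ x z   → Excluded (4 + x) 1 (3 + z)
  ⊇Ẽ₈  : ∀ z     → Excluded 2 2 (5 + z)
  ⊇Ẽ₈′ : ∀ z     → Excluded 3 1 (5 + z)
  ⊇Ẽ₈″ : ∀ x     → Excluded (6 + x) 1 2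
  E₆   : Excluded 2 2 2
  E₇   : Excluded 2 2 3
  E₇′  : Excluded 3 1 3
  E₈   : Excluded 2 2 4
  E₈′  : Excluded 3 1 4
  E₈″  : Excluded 5 1 2

excluded-no-minuscule : ∀ {i j k} → Excluded i j k → ∀ n P → ¬ MinusculeWithTopTreeY i j k n P
excluded-no-minuscule (⊇Ẽ₆ zero y z)    = Shape.excluded-through-root 2 0 1 y 1 z (lookup Ẽ₆) tt tt
excluded-no-minuscule (⊇Ẽ₆ (suc x) y z) =
  Shape.excluded-with-neighbour 3 x 1 y 1 z (lookup (map lowered Ẽ₆)) tt (T 0) tt
excluded-no-minuscule (⊇Ẽ₇ y z)         = Shape.excluded-through-root 1 0 2 y 2 z (lookup Ẽ₇) tt tt
excluded-no-minuscule (⊇Ẽ₇′ zero z)     = Shape.excluded-through-root 3 0 0 0 2 z (lookup Ẽ₇′) tt tt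
excluded-no-minuscule (⊇Ẽ₇′ (suc x) z)  =
  Shape.excluded-with-neighbour 4 x 0 0 2 z (lookup (map lowered Ẽ₇′)) tt (T 0) tt
excluded-no-minuscule (⊇Ẽ₈ z)           = Shape.excluded-through-root 1 0 1 0 4 z (lookup Ẽ₈) tt tt
excluded-no-minuscule (⊇Ẽ₈′ z)          = Shape.excluded-through-root 2 0 0 0 4 z (lookup Ẽ₈′) tt tt
excluded-no-minuscule (⊇Ẽ₈″ zero)       = Shape.excluded-through-root 5 0 0 0 1 0 (lookup Ẽ₈″) tt tt
excluded-no-minuscule (⊇Ẽ₈″ (suc x))    =
  Shape.excluded-with-neighbour 6 x 0 0 1 0 (lookup (map lowered Ẽ₈″)) tt (T 0) tt
-- 40 exceeds the length of every reflection chain explored below.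
excluded-no-minuscule E₆  = excluded-by-exploration 40 tt
excluded-no-minuscule E₇  = excluded-by-exploration 40 tt
excluded-no-minuscule E₇′ = excluded-by-exploration 40 tt
excluded-no-minuscule E₈  = excluded-by-exploration 40 tt
excluded-no-minuscule E₈′ = excluded-by-exploration 40 tt
excluded-no-minuscule E₈″ = excluded-by-exploration 40 tt

excluded-a : ∀ i j k → 1 < i → 1 < j → j ≤ k → Excluded i j k
excluded-a 2 2 2 _ _ _ = E₆
excluded-a 2 2 3 _ _ _ = E₇
excluded-a 2 2 4 _ _ _ = E₈
excluded-a 2 2 (suc (suc (suc (suc (suc z))))) _ _ _ = ⊇Ẽ₈ z
excluded-a 2 (suc (suc (suc y))) (suc (suc (suc z))) _ _ _ = ⊇Ẽ₇ y z
excluded-a (suc (suc (suc x))) (suc (suc y)) (suc (suc z)) _ _ _ = ⊇Ẽ₆ x y z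
excluded-a 0 _ _ () _ _
excluded-a 1 _ _ (s≤s ()) _ _
excluded-a _ 0 _ _ () _
excluded-a _ 1 _ _ (s≤s ()) _
excluded-a _ (suc (suc _)) 0 _ _ ()
excluded-a _ (suc (suc _)) 1 _ _ (s≤s ())
excluded-a 2 (suc (suc (suc _))) 2 _ _ (s≤s (s≤s ()))

excluded-b : ∀ i k → 2 < i → 2 < k → Excluded i 1 k
excluded-b 3 3 _ _ = E₇′
excluded-b 3 4 _ _ = E₈′
excluded-b 3 (suc (suc (suc (suc (suc z))))) _ _ = ⊇Ẽ₈′ z
excluded-b (suc (suc (suc (suc x)))) (suc (suc (suc z))) _ _ = ⊇Ẽ₇′ x z
excluded-b 0 _ () _
excluded-b 1 _ (s≤s ()) _
excluded-b 2 _ (s≤s (s≤s ())) _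
excluded-b _ 0 _ ()
excluded-b _ 1 _ (s≤s ())
excluded-b _ 2 _ (s≤s (s≤s ()))

excluded-c : ∀ i → 4 < i → Excluded i 1 2
excluded-c 5 _ = E₈″
excluded-c (suc (suc (suc (suc (suc (suc x)))))) _ = ⊇Ẽ₈″ x
excluded-c 0 ()
excluded-c 1 (s≤s ())
excluded-c 2 (s≤s (s≤s ()))
excluded-c 3 (s≤s (s≤s (s≤s ())))
excluded-c 4 (s≤s (s≤s (s≤s (s≤s ()))))

excluded-cases : ∀ i j k → j ≤ k →
  (1 < i × 1 < j) ⊎ (2 < i × j ≡ 1 × 2 < k) ⊎ (4 < i × j ≡ 1 × k ≡ 2) → Excluded i j k
excluded-cases i j k j≤k (inj₁ (1<i , 1<j))                  = excluded-a i j k 1<i 1<j j≤k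
excluded-cases i _ k _   (inj₂ (inj₁ (2<i , refl , 2<k)))    = excluded-b i k 2<i 2<k
excluded-cases i _ _ _   (inj₂ (inj₂ (4<i , refl , refl)))   = excluded-c i 4<i

proposition7p2 : (i j k : ℕ) → 1 ≤ i → 1 ≤ j → j ≤ k →
    ((1 < i × 1 < j) ⊎ (2 < i × j ≡ 1 × 2 < k) ⊎ (4 < i × j ≡ 1 × k ≡ 2)) →
    (n : ℕ) (P : ColoredPoset (Node i j k) n) → ¬ MinusculeWithTopTreeY i j k n P
-- 1 ≤ i and 1 ≤ j already follow from the case hypothesis.
proposition7p2 i j k _ _ j≤k cases = excluded-no-minuscule (excluded-cases i j k j≤k cases)
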